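{- Let $\alpha\in\mathrm{KrInt}(n)$, whose only possibly non-singleton block is $Q_\alpha\sqcup\{n\}$ with $Q_\alpha\subseteq[n-1]$, and let $\beta\in\mathrm{NC}(n)$ with $\beta(n)$ its block containing $n$. Then $\alpha\wedge_{\mathrm{KrInt}}\beta$ is the partition whose only possibly non-singleton block is $(Q_\alpha\sqcup\{n\})\cap\beta(n)$ (all other elements being singletons). In particular, if $\beta\in\mathrm{KrInt}(n)$ then $\alpha\wedge_{\mathrm{KrInt}}\beta=\alpha\wedge\beta$.
   Context: $\mathrm{NC}(n)$ is the set of non-crossing partitions of $[n]$, ordered by $\rho\le\tau$ iff each block of $\rho$ lies in a block of $\tau$; $\alpha\wedge\beta$ is the meet (largest common lower bound) in $\mathrm{NC}(n)$. $\mathrm{Int}(n)$ is the set of interval partitions. Identifying partitions with permutations whose cycles are blocks in increasing order and $\gamma_n=(1\,2\,\cdots\,n)$, the Kreweras complement is $\alpha^{\mathrm{Kr}}=\alpha^{ -1}\gamma_n$ and $\mathrm{KrInt}(n)=\{\alpha^{\mathrm{Kr}}:\alpha\in\mathrm{Int}(n)\}$; its elements are exactly the partitions of $[n]$ with one block $Q\sqcup\{n\}$, $Q\subseteq[n-1]$, and all other blocks singletons. For $\alpha,\beta\in\mathrm{NC}(n)$, $\alpha\wedge_{\mathrm{KrInt}}\beta=\max\{\rho\in\mathrm{KrInt}(n):\rho\le\alpha,\rho\le\beta\}$. -}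

module Defs where

open import Data.Nat using (ℕ; zero; suc)
open import Data.Bool using (Bool; true; false; if_then_else_; _∧_)
open import Data.Fin using (Fin; zero; suc; toℕ; fromℕ; _<_)
open import Data.Vec using (Vec; []; _∷_)
open import Data.Product using (Σ; _×_)
open import Relation.Binary.PropositionalEquality using (_≡_)
open import Relation.Nullary.Decidable using (⌊_⌋)
import Data.Nat as ℕ

-- We work on [n] with n = suc m ≥ 1, elements represented by Fin (suc m):
-- index k : Fin (suc m) stands for the element k+1 of [n]; the element n is
-- 'lastₙ m = fromℕ m'.

-- A set partition of [n], encoded by a block-label function: i and j lie in
-- the same block iff they have the same label.
Partition : ℕ → Set
Partition n = Fin n → ℕ

_∼⟨_⟩_ : ∀ {n} → Fin n → Partition n → Fin n → Set
i ∼⟨ ρ ⟩ j = ρ i ≡ ρ j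

_≤ₚ_ : ∀ {n} → Partition n → Partition n → Set
ρ ≤ₚ τ = ∀ i j → i ∼⟨ ρ ⟩ j → i ∼⟨ τ ⟩ j

_≈ₚ_ : ∀ {n} → Partition n → Partition n → Set
ρ ≈ₚ τ = (ρ ≤ₚ τ) × (τ ≤ₚ ρ)

IsNC : ∀ {n} → Partition n → Set
IsNC {n} ρ = ∀ (a b c d : Fin n) → a < b → b < c → c < d →
  a ∼⟨ ρ ⟩ c → b ∼⟨ ρ ⟩ d → a ∼⟨ ρ ⟩ b

lastₙ : ∀ m → Fin (suc m)
lastₙ m = fromℕ m

-- For Q ⊆ [n-1] (a subset of Fin m, as a Bool vector), membership in Q ⊔ {n}.
inQn : ∀ {m} → Vec Bool m → Fin (suc m) → Bool
inQn {zero} [] zero = true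
inQn {suc m} (b ∷ Q) zero = b
inQn {suc m} (b ∷ Q) (suc i) = inQn Q i

krIntPart : ∀ {m} → Vec Bool m → Partition (suc m)
krIntPart Q i = if inQn Q i then 0 else suc (toℕ i)

IsKrInt : ∀ {m} → Partition (suc m) → Set
IsKrInt {m} ρ = Σ (Vec Bool m) λ Q → ρ ≈ₚ krIntPart Q

krIntMeetCandidate : ∀ {m} → Vec Bool m → Partition (suc m) → Partition (suc m)
krIntMeetCandidate {m} Q β i =
  if inQn Q i ∧ ⌊ β i ℕ.≟ β (lastₙ m) ⌋ then 0 else suc (toℕ i)

IsKrIntMeet : ∀ {m} → Partition (suc m) → Partition (suc m) → Partition (suc m) → Set
IsKrIntMeet ρ α β =
  IsKrInt ρ × ρ ≤ₚ α × ρ ≤ₚ β ×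
  (∀ σ → IsKrInt σ → σ ≤ₚ α → σ ≤ₚ β → σ ≤ₚ ρ)

IsNCMeet : ∀ {n} → Partition n → Partition n → Partition n → Set
IsNCMeet ρ α β =
  IsNC ρ × ρ ≤ₚ α × ρ ≤ₚ β ×
  (∀ σ → IsNC σ → σ ≤ₚ α → σ ≤ₚ β → σ ≤ₚ ρ)

-- A partition in KrInt(n) has a single possibly non-singleton block, the one
-- containing n.  Hence every partition of that shape lies below both α and β
-- exactly when its block of n lies in α(n) ∩ β(n) = (Q_α ⊔ {n}) ∩ β(n), so the
-- largest such partition has that intersection as its block of n.  Any
-- partition with one non-singleton block is non-crossing, and when β is also in
-- KrInt(n) every common lower bound in NC(n) already has all its non-trivial
-- pairs inside α(n) ∩ β(n), so the same partition is the meet in NC(n).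
module Submission where

open import Defs
open import Data.Nat using (ℕ; zero; suc)
import Data.Nat as ℕ
open import Data.Nat.Properties using (0≢1+n; suc-injective)
open import Data.Bool using (Bool; true; false; T; _∧_; if_then_else_)
open import Data.Bool.Properties using (T-∧; T-≡)
open import Data.Fin using (Fin; zero; suc; toℕ; inject₁)
open import Data.Fin.Properties using (toℕ-injective; <-irrefl; <-trans)
open import Data.Vec using (Vec; []; _∷_; tabulate)
open import Data.Product using (_×_; _,_; proj₁; proj₂)
open import Data.Sum using (_⊎_; inj₁; inj₂)
open import Data.Unit using (tt)
open import Data.Empty using (⊥-elim)
open import Function using (_∘_; Equivalence)
open import Relation.Nullary.Decidable using (⌊_⌋; toWitness; fromWitness)
open import Relation.Binary.PropositionalEquality using (_≡_; refl; sym; trans; cong)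

open Equivalence using (to; from)

oneBlock : ∀ {n} → (Fin n → Bool) → Partition n
oneBlock f i = if f i then 0 else suc (toℕ i)

SingletonsOutside : ∀ {n} → Partition n → (Fin n → Set) → Set
SingletonsOutside {n} σ P = ∀ i j → i ∼⟨ σ ⟩ j → i ≡ j ⊎ (P i × P j)

module _ {n} {σ : Partition n} where

  singletonsOutside-mono : ∀ {P R : Fin n → Set} → (∀ i → P i → R i) →
    SingletonsOutside σ P → SingletonsOutside σ R
  singletonsOutside-mono P⇒R σ-P i j i∼j with σ-P i j i∼j
  ... | inj₁ i≡j = inj₁ i≡j
  ... | inj₂ (Pi , Pj) = inj₂ (P⇒R i Pi , P⇒R j Pj)

  singletonsOutside-∩ : ∀ {P R : Fin n → Set} →
    SingletonsOutside σ P → SingletonsOutside σ R →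
    SingletonsOutside σ (λ i → P i × R i)
  singletonsOutside-∩ σ-P σ-R i j i∼j with σ-P i j i∼j | σ-R i j i∼j
  ... | inj₁ i≡j | _ = inj₁ i≡j
  ... | inj₂ _ | inj₁ i≡j = inj₁ i≡j
  ... | inj₂ (Pi , Pj) | inj₂ (Ri , Rj) = inj₂ ((Pi , Ri) , (Pj , Rj))

  singletonsOutside-≤ : ∀ {τ P} → σ ≤ₚ τ → SingletonsOutside τ P → SingletonsOutside σ P
  singletonsOutside-≤ σ≤τ τ-P i j i∼j = τ-P i j (σ≤τ i j i∼j)

module _ {n} (f : Fin n → Bool) where

  oneBlock-marked : ∀ i j → T (f i) → T (f j) → i ∼⟨ oneBlock f ⟩ j
  oneBlock-marked i j fi fj with f i | f j
  ... | true | true = refl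

  oneBlock-singletonsOutside : SingletonsOutside (oneBlock f) (T ∘ f)
  oneBlock-singletonsOutside i j i∼j with f i | f j
  ... | true  | true  = inj₂ (tt , tt)
  ... | true  | false = ⊥-elim (0≢1+n i∼j)
  ... | false | true  = ⊥-elim (0≢1+n (sym i∼j))
  ... | false | false = inj₁ (toℕ-injective (suc-injective i∼j))

  oneBlock-≤ : ∀ {τ} → (∀ i j → T (f i) → T (f j) → i ∼⟨ τ ⟩ j) → oneBlock f ≤ₚ τ
  oneBlock-≤ marked⇒∼ i j i∼j with oneBlock-singletonsOutside i j i∼j
  ... | inj₁ refl = refl
  ... | inj₂ (fi , fj) = marked⇒∼ i j fi fj

  ≤-oneBlock : ∀ {σ} → SingletonsOutside σ (T ∘ f) → σ ≤ₚ oneBlock f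
  ≤-oneBlock σ-f i j i∼j with σ-f i j i∼j
  ... | inj₁ refl = refl
  ... | inj₂ (fi , fj) = oneBlock-marked i j fi fj

  oneBlock-isNC : IsNC (oneBlock f)
  oneBlock-isNC a b c d a<b b<c c<d a∼c b∼d
    with oneBlock-singletonsOutside a c a∼c | oneBlock-singletonsOutside b d b∼d
  ... | inj₁ refl | _ = ⊥-elim (<-irrefl refl (<-trans a<b b<c))
  ... | inj₂ _ | inj₁ refl = ⊥-elim (<-irrefl refl (<-trans b<c c<d))
  ... | inj₂ (fa , _) | inj₂ (fb , _) = oneBlock-marked a b fa fb

≈ₚ-pointwise : ∀ {n} {ρ τ : Partition n} → (∀ i → ρ i ≡ τ i) → ρ ≈ₚ τ
≈ₚ-pointwise ρ≗τ =
  (λ i j i∼j → trans (sym (ρ≗τ i)) (trans i∼j (ρ≗τ j))) ,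
  (λ i j i∼j → trans (ρ≗τ i) (trans i∼j (sym (ρ≗τ j))))

inQn-last : ∀ {m} (Q : Vec Bool m) → T (inQn Q (lastₙ m))
inQn-last []      = tt
inQn-last (_ ∷ Q) = inQn-last Q

inQn-tabulate : ∀ {m} (f : Fin (suc m) → Bool) → T (f (lastₙ m)) →
  ∀ i → inQn (tabulate (f ∘ inject₁)) i ≡ f i
inQn-tabulate {zero}  f fn zero    = sym (to T-≡ fn)
inQn-tabulate {suc m} f fn zero    = refl
inQn-tabulate {suc m} f fn (suc i) = inQn-tabulate (f ∘ suc) fn i

oneBlock-isKrInt : ∀ {m} (f : Fin (suc m) → Bool) → T (f (lastₙ m)) → IsKrInt (oneBlock f)
oneBlock-isKrInt f fn =
  tabulate (f ∘ inject₁) ,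
  ≈ₚ-pointwise (λ i → cong (λ b → if b then 0 else suc (toℕ i)) (sym (inQn-tabulate f fn i)))

module _ {m} {ρ : Partition (suc m)} {Q : Vec Bool m} (ρ≈ : ρ ≈ₚ krIntPart Q) where

  inQn⇒∼last : ∀ i → T (inQn Q i) → i ∼⟨ ρ ⟩ lastₙ m
  inQn⇒∼last i Qi = proj₂ ρ≈ i _ (oneBlock-marked (inQn Q) i _ Qi (inQn-last Q))

  ∼last⇒inQn : ∀ i → i ∼⟨ ρ ⟩ lastₙ m → T (inQn Q i)
  ∼last⇒inQn i i∼n with oneBlock-singletonsOutside (inQn Q) i _ (proj₁ ρ≈ i _ i∼n)
  ... | inj₁ refl = inQn-last Q
  ... | inj₂ (Qi , _) = Qi

  krInt-singletonsOutside : SingletonsOutside ρ (λ i → i ∼⟨ ρ ⟩ lastₙ m)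
  krInt-singletonsOutside =
    singletonsOutside-mono inQn⇒∼last
      (singletonsOutside-≤ (proj₁ ρ≈) (oneBlock-singletonsOutside (inQn Q)))

module KrIntMeetCandidate {m} {α : Partition (suc m)} {Q : Vec Bool m}
                          (α≈ : α ≈ₚ krIntPart Q) (β : Partition (suc m)) where

  InBothBlocksOfLast : Fin (suc m) → Set
  InBothBlocksOfLast i = i ∼⟨ α ⟩ lastₙ m × i ∼⟨ β ⟩ lastₙ m

  inMeetBlock : Fin (suc m) → Bool
  inMeetBlock i = inQn Q i ∧ ⌊ β i ℕ.≟ β (lastₙ m) ⌋

  inMeetBlock-sound : ∀ i → T (inMeetBlock i) → InBothBlocksOfLast i
  inMeetBlock-sound i marked with to T-∧ marked
  ... | Qi , βi≡βn = inQn⇒∼last α≈ i Qi , toWitness βi≡βn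

  inMeetBlock-complete : ∀ i → InBothBlocksOfLast i → T (inMeetBlock i)
  inMeetBlock-complete i (i∼αn , i∼βn) = from T-∧ (∼last⇒inQn α≈ i i∼αn , fromWitness i∼βn)

  candidate-isKrInt : IsKrInt (krIntMeetCandidate Q β)
  candidate-isKrInt = oneBlock-isKrInt inMeetBlock (inMeetBlock-complete _ (refl , refl))

  candidate-≤ : ∀ {τ} → (∀ i → InBothBlocksOfLast i → i ∼⟨ τ ⟩ lastₙ m) →
    krIntMeetCandidate Q β ≤ₚ τ
  candidate-≤ inBoth⇒∼n = oneBlock-≤ inMeetBlock λ i j mi mj →
    trans (inBoth⇒∼n i (inMeetBlock-sound i mi)) (sym (inBoth⇒∼n j (inMeetBlock-sound j mj)))

  ≤-candidate : ∀ {σ} → SingletonsOutside σ InBothBlocksOfLast → σ ≤ₚ krIntMeetCandidate Q β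
  ≤-candidate σ-both = ≤-oneBlock inMeetBlock (singletonsOutside-mono inMeetBlock-complete σ-both)

lemma3p11 : ∀ (m : ℕ) (α : Partition (ℕ.suc m)) (Q : Vec Bool m) →
    α ≈ₚ krIntPart Q →
    (β : Partition (ℕ.suc m)) → IsNC β →
    IsKrIntMeet (krIntMeetCandidate Q β) α β ×
    (IsKrInt β → IsNCMeet (krIntMeetCandidate Q β) α β)
lemma3p11 m α Q α≈ β _ =
  (candidate-isKrInt , C≤α , C≤β , greatestInKrInt) ,
  λ β-krInt → (oneBlock-isNC inMeetBlock , C≤α , C≤β , greatestInNC β-krInt)
  where
  open KrIntMeetCandidate α≈ β
  C≤α : krIntMeetCandidate Q β ≤ₚ α
  C≤α = candidate-≤ (λ _ → proj₁)
  C≤β : krIntMeetCandidate Q β ≤ₚ β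
  C≤β = candidate-≤ (λ _ → proj₂)

  greatestInKrInt : ∀ σ → IsKrInt σ → σ ≤ₚ α → σ ≤ₚ β → σ ≤ₚ krIntMeetCandidate Q β
  greatestInKrInt σ (_ , σ≈) σ≤α σ≤β =
    ≤-candidate (singletonsOutside-mono (λ i i∼n → σ≤α i _ i∼n , σ≤β i _ i∼n)
                                        (krInt-singletonsOutside σ≈))

  greatestInNC : IsKrInt β → ∀ σ → IsNC σ → σ ≤ₚ α → σ ≤ₚ β → σ ≤ₚ krIntMeetCandidate Q β
  greatestInNC (_ , β≈) σ _ σ≤α σ≤β =
    ≤-candidate (singletonsOutside-∩ (singletonsOutside-≤ σ≤α (krInt-singletonsOutside α≈))
                                     (singletonsOutside-≤ σ≤β (krInt-singletonsOutside β≈)))
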